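{- For every integer $s$ and all positive integers $k,n$, there exists an integer $K$ such that $$f_{kn}(s,-1)=2^{1-k} f_n(s,-1)\bigl(K f_n(s,-1)^2+k\, g_n(s,-1)^{k-1}\bigr).$$
   Context: For integers $s,t$: the generalized Fibonacci sequence is $f_0(s,t)=0$, $f_1(s,t)=1$, $f_n(s,t)=s f_{n-1}(s,t)+t f_{n-2}(s,t)$ for $n\ge2$; the generalized Lucas sequence is $g_0(s,t)=2$, $g_1(s,t)=s$, $g_n(s,t)=s g_{n-1}(s,t)+t g_{n-2}(s,t)$ for $n\ge 2$. -}

module Defs where

open import Data.Nat using (ℕ; zero; suc)
open import Data.Integer using (ℤ; +_; _+_; _*_)

fib : ℤ → ℤ → ℕ → ℤ
fib s t zero = + 0
fib s t (suc zero) = + 1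
fib s t (suc (suc n)) = s * fib s t (suc n) + t * fib s t n

luc : ℤ → ℤ → ℕ → ℤ
luc s t zero = + 2
luc s t (suc zero) = s
luc s t (suc (suc n)) = s * luc s t (suc n) + t * luc s t n

module Submission where

-- Idea of the proof.  Write f = fib s t, g = luc s t and D = s² + 4t; the
-- theorem is the case t = -1 of a statement valid for all s, t.
--
-- 1. Both f and g satisfy u (n+2) = s·u (n+1) + t·u n.  Solutions of this
--    recurrence form a module closed under translation and linear
--    combination, and a solution is determined by its first two values.
-- 2. Comparing initial values then yields the addition formulas
--        2 f (m+c) = g c · f m + f c · g m,
--        2 g (m+c) = g c · g m + D f c · f m.
-- 3. Applying them to (j+2)n = n + (j+1)n shows by induction on j that
--        2^j f ((j+1)n) = f n · (K f n² + (j+1) g n^j),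
--        2^j g ((j+1)n) = g n^(j+1) + f n² · M
--    for some integers K, M; the first formula with k = j + 1 is the theorem.

open import Defs
open import Data.Nat using (ℕ; zero; suc; _≤_; _∸_)
open import Data.Nat.Properties using (+-identityʳ)
open import Data.Integer using (ℤ; +_; -_; _*_; _+_; _^_)
open import Data.Product using (∃; ∃₂; _,_; _×_)
open import Relation.Binary.PropositionalEquality
  using (_≡_; refl; sym; trans; cong; cong₂; module ≡-Reasoning)
open import Data.Integer.Tactic.RingSolver using (solve-∀)

module _ (s t : ℤ) where
  open ≡-Reasoning

  -- The ring identities below are closed formulas proved by solve-∀: they
  -- quantify over s, t, D as well (the solver cannot treat these as
  -- constants), and write x ^ 2 as its unfolding x * (x * 1), since the
  -- solver does not handle _^_ on ℤ.

  private
    f g : ℕ → ℤ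
    f = fib s t
    g = luc s t

  -- The discriminant s² + 4t of the characteristic polynomial x² - s x - t.
  D : ℤ
  D = s * s + (+ 4) * t

  Recurrent : (ℕ → ℤ) → Set
  Recurrent u = ∀ n → u (suc (suc n)) ≡ s * u (suc n) + t * u n

  fib-recurrent : Recurrent f
  fib-recurrent n = refl

  luc-recurrent : Recurrent g
  luc-recurrent n = refl

  -- The recurrence is translation invariant (suc m + c reduces to suc (m + c)).
  translate-recurrent : ∀ {u} c → Recurrent u → Recurrent (λ m → u (m Data.Nat.+ c))
  translate-recurrent c rec m = rec (m Data.Nat.+ c)

  combination-recurrent : ∀ {u v w} (a b : ℤ) → Recurrent u → Recurrent v →
                          (∀ n → w n ≡ a * u n + b * v n) → Recurrent w
  combination-recurrent {u} {v} {w} a b u-rec v-rec w≡ n = begin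
    w (suc (suc n))                                    ≡⟨ w≡ (suc (suc n)) ⟩
    a * u (suc (suc n)) + b * v (suc (suc n))          ≡⟨ cong₂ (λ x y → a * x + b * y) (u-rec n) (v-rec n) ⟩
    a * (s * u (suc n) + t * u n) + b * (s * v (suc n) + t * v n)
                                                       ≡⟨ regroup s t a b (u (suc n)) (u n) (v (suc n)) (v n) ⟩
    s * (a * u (suc n) + b * v (suc n)) + t * (a * u n + b * v n)
                                                       ≡⟨ sym (cong₂ (λ x y → s * x + t * y) (w≡ (suc n)) (w≡ n)) ⟩
    s * w (suc n) + t * w n                            ∎
    where
    regroup : ∀ s t a b x₁ x₀ y₁ y₀ →
              a * (s * x₁ + t * x₀) + b * (s * y₁ + t * y₀)
                ≡ s * (a * x₁ + b * y₁) + t * (a * x₀ + b * y₀)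
    regroup = solve-∀

  scale-recurrent : ∀ {u} a → Recurrent u → Recurrent (λ n → a * u n)
  scale-recurrent a u-rec = combination-recurrent a (+ 0) u-rec u-rec (λ n → add-zero a _)
    where
    add-zero : ∀ a x → a * x ≡ a * x + (+ 0) * x
    add-zero = solve-∀

  recurrence-determined : ∀ {u v} → Recurrent u → Recurrent v →
                          u 0 ≡ v 0 → u 1 ≡ v 1 → ∀ n → u n ≡ v n
  recurrence-determined {u} {v} u-rec v-rec eq₀ eq₁ = agree
    where
    agree : ∀ n → u n ≡ v n
    agree zero          = eq₀
    agree (suc zero)    = eq₁
    agree (suc (suc n)) = begin
      u (suc (suc n))             ≡⟨ u-rec n ⟩
      s * u (suc n) + t * u n     ≡⟨ cong₂ (λ x y → s * x + t * y) (agree (suc n)) (agree n) ⟩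
      s * v (suc n) + t * v n     ≡⟨ sym (v-rec n) ⟩
      v (suc (suc n))             ∎

  -- Shift formulas: the addition formulas below in the case m = 1, needed
  -- there as the second initial value.  (f ∘ suc and g ∘ suc are solutions
  -- by definition.)
  fib-shift : ∀ n → (+ 2) * f (suc n) ≡ g n + s * f n
  fib-shift = recurrence-determined {λ n → (+ 2) * f (suc n)} {λ n → g n + s * f n}
    (scale-recurrent (+ 2) (λ n → refl))
    (combination-recurrent (+ 1) s luc-recurrent fib-recurrent (λ n → unit-coefficient s (g n) (f n)))
    (at-zero s)
    (at-one s t)
    where
    at-zero : ∀ s → (+ 2) * (+ 1) ≡ (+ 2) + s * (+ 0)
    at-zero = solve-∀
    at-one : ∀ s t → (+ 2) * (s * (+ 1) + t * (+ 0)) ≡ s + s * (+ 1)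
    at-one = solve-∀
    unit-coefficient : ∀ s x y → x + s * y ≡ (+ 1) * x + s * y
    unit-coefficient = solve-∀

  luc-shift : ∀ n → (+ 2) * g (suc n) ≡ s * g n + D * f n
  luc-shift = recurrence-determined {λ n → (+ 2) * g (suc n)} {λ n → s * g n + D * f n}
    (scale-recurrent (+ 2) (λ n → refl))
    (combination-recurrent s D luc-recurrent fib-recurrent (λ n → refl))
    (at-zero s t)
    (at-one s t)
    where
    at-zero : ∀ s t → (+ 2) * s ≡ s * (+ 2) + (s * s + (+ 4) * t) * (+ 0)
    at-zero = solve-∀
    at-one : ∀ s t → (+ 2) * (s * s + t * (+ 2)) ≡ s * s + (s * s + (+ 4) * t) * (+ 1)
    at-one = solve-∀

  -- Addition formulas, proved as identities between solutions in m for fixed c.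
  fib-add : ∀ m c → (+ 2) * f (m Data.Nat.+ c) ≡ g c * f m + f c * g m
  fib-add m c = recurrence-determined {λ m → (+ 2) * f (m Data.Nat.+ c)} {λ m → g c * f m + f c * g m}
    (scale-recurrent (+ 2) (translate-recurrent c fib-recurrent))
    (combination-recurrent (g c) (f c) fib-recurrent luc-recurrent (λ m → refl))
    (at-zero (g c) (f c))
    (trans (fib-shift c) (at-one s (g c) (f c)))
    m
    where
    at-zero : ∀ x y → (+ 2) * y ≡ x * (+ 0) + y * (+ 2)
    at-zero = solve-∀
    at-one : ∀ s x y → x + s * y ≡ x * (+ 1) + y * s
    at-one = solve-∀

  luc-add : ∀ m c → (+ 2) * g (m Data.Nat.+ c) ≡ g c * g m + (D * f c) * f m
  luc-add m c = recurrence-determined {λ m → (+ 2) * g (m Data.Nat.+ c)} {λ m → g c * g m + (D * f c) * f m}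
    (scale-recurrent (+ 2) (translate-recurrent c luc-recurrent))
    (combination-recurrent (g c) (D * f c) luc-recurrent fib-recurrent (λ m → refl))
    (at-zero D (g c) (f c))
    (trans (luc-shift c) (at-one s D (g c) (f c)))
    m
    where
    at-zero : ∀ D x y → (+ 2) * x ≡ x * (+ 2) + (D * y) * (+ 0)
    at-zero = solve-∀
    at-one : ∀ s D x y → s * x + D * y ≡ x * s + (D * y) * (+ 1)
    at-one = solve-∀

  FibPower : ℕ → ℕ → ℤ → Set
  FibPower n j K = (+ 2) ^ j * f (suc j Data.Nat.* n) ≡ f n * (K * f n ^ 2 + (+ suc j) * g n ^ j)

  LucPower : ℕ → ℕ → ℤ → Set
  LucPower n j M = (+ 2) ^ j * g (suc j Data.Nat.* n) ≡ g n ^ suc j + f n ^ 2 * M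

  -- One factor 2 of 2^(j+1) is used to apply an addition formula.
  peel-two : ∀ q y → ((+ 2) * q) * y ≡ q * ((+ 2) * y)
  peel-two = solve-∀

  -- Inductive step for f, via f ((j+2)n) = f (n + (j+1)n) and fib-add.
  fib-power-step : ∀ {n j K M} → FibPower n j K → LucPower n j M → FibPower n (suc j) (M + g n * K)
  fib-power-step {n} {j} {K} {M} fib-eq luc-eq = begin
    (+ 2) ^ suc j * f (n Data.Nat.+ X)                   ≡⟨ peel-two q _ ⟩
    q * ((+ 2) * f (n Data.Nat.+ X))                     ≡⟨ cong (q *_) (fib-add n X) ⟩
    q * (g X * f n + f X * g n)                          ≡⟨ distribute q (f n) (g n) (g X) (f X) ⟩
    f n * (q * g X) + g n * (q * f X)                    ≡⟨ cong₂ (λ x y → f n * x + g n * y) luc-eq fib-eq ⟩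
    f n * (g n ^ suc j + f n ^ 2 * M)
      + g n * (f n * (K * f n ^ 2 + (+ suc j) * g n ^ j)) ≡⟨ collect (f n) (g n) (g n ^ j) K M (+ suc j) ⟩
    f n * ((M + g n * K) * f n ^ 2 + (+ suc (suc j)) * g n ^ suc j) ∎
    where
    X : ℕ
    X = suc j Data.Nat.* n
    q : ℤ
    q = (+ 2) ^ j
    distribute : ∀ q F G x y → q * (x * F + y * G) ≡ F * (q * x) + G * (q * y)
    distribute = solve-∀
    collect : ∀ F G P K M c →
              F * (G * P + (F * (F * (+ 1))) * M) + G * (F * (K * (F * (F * (+ 1))) + c * P))
                ≡ F * ((M + G * K) * (F * (F * (+ 1))) + ((+ 1) + c) * (G * P))
    collect = solve-∀

  -- Inductive step for g, via g ((j+2)n) = g (n + (j+1)n) and luc-add.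
  luc-power-step : ∀ {n j K M} → FibPower n j K → LucPower n j M →
                   LucPower n (suc j) (g n * M + D * (K * f n ^ 2 + (+ suc j) * g n ^ j))
  luc-power-step {n} {j} {K} {M} fib-eq luc-eq = begin
    (+ 2) ^ suc j * g (n Data.Nat.+ X)                   ≡⟨ peel-two q _ ⟩
    q * ((+ 2) * g (n Data.Nat.+ X))                     ≡⟨ cong (q *_) (luc-add n X) ⟩
    q * (g X * g n + (D * f X) * f n)                    ≡⟨ distribute D q (f n) (g n) (g X) (f X) ⟩
    g n * (q * g X) + D * f n * (q * f X)                ≡⟨ cong₂ (λ x y → g n * x + D * f n * y) luc-eq fib-eq ⟩
    g n * (g n ^ suc j + f n ^ 2 * M)
      + D * f n * (f n * (K * f n ^ 2 + (+ suc j) * g n ^ j))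
                                                         ≡⟨ collect D (f n) (g n) (g n ^ j) K M (+ suc j) ⟩
    g n ^ suc (suc j) + f n ^ 2 * (g n * M + D * (K * f n ^ 2 + (+ suc j) * g n ^ j)) ∎
    where
    X : ℕ
    X = suc j Data.Nat.* n
    q : ℤ
    q = (+ 2) ^ j
    distribute : ∀ D q F G x y → q * (x * G + (D * y) * F) ≡ G * (q * x) + D * F * (q * y)
    distribute = solve-∀
    collect : ∀ D F G P K M c →
              G * (G * P + (F * (F * (+ 1))) * M) + D * F * (F * (K * (F * (F * (+ 1))) + c * P))
                ≡ G * (G * P) + (F * (F * (+ 1))) * (G * M + D * (K * (F * (F * (+ 1))) + c * P))
    collect = solve-∀

  power-formulas : ∀ n j → ∃₂ λ K M → FibPower n j K × LucPower n j M
  power-formulas n zero rewrite +-identityʳ n =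
    + 0 , + 0 , base-fib (f n) , base-luc (g n) (f n)
    where
    base-fib : ∀ F → (+ 1) * F ≡ F * ((+ 0) * (F * (F * (+ 1))) + (+ 1) * (+ 1))
    base-fib = solve-∀
    base-luc : ∀ G F → (+ 1) * G ≡ G * (+ 1) + (F * (F * (+ 1))) * (+ 0)
    base-luc = solve-∀
  power-formulas n (suc j) with power-formulas n j
  ... | K , M , fib-eq , luc-eq =
    M + g n * K , g n * M + D * (K * f n ^ 2 + (+ suc j) * g n ^ j) ,
    fib-power-step {n} {j} {K} {M} fib-eq luc-eq , luc-power-step {n} {j} {K} {M} fib-eq luc-eq

lemma2 : (s : ℤ) (k n : ℕ) → 1 ≤ k → 1 ≤ n →
    ∃ λ (K : ℤ) →
      (+ 2) ^ (k ∸ 1) * fib s (- + 1) (k Data.Nat.* n)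
        ≡ fib s (- + 1) n * (K * fib s (- + 1) n ^ 2 + (+ k) * luc s (- + 1) n ^ (k ∸ 1))
lemma2 s (suc j) n _ _ with power-formulas s (- + 1) n j
... | K , _ , fib-formula , _ = K , fib-formula
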